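{- Let $k\ge 2$ be an integer and let $n \geq 3k^2-6k+6$. Then every permutation in $S_n$ is equivalent, under the $\{12\cdots k,\ k\cdots 21\}$-equivalence, to some permutation in $S_n$ whose first letter is $1$.
   Context: $S_n$ is the set of permutations of $\{1,\dots,n\}$ written as words. A pattern-replacement under the $\{12\cdots k, k\cdots 21\}$-equivalence takes $k$ letters of a permutation, at arbitrary (not necessarily adjacent) positions, that are in increasing (resp. decreasing) order and rearranges them within those positions into decreasing (resp. increasing) order; two permutations are equivalent if one is reachable from the other by finitely many such replacements. -}

module Defs where

open import Data.Nat using (ℕ; suc)
open import Data.Fin using (Fin; zero; opposite; _<_; _>_)
open import Data.Product using (Σ; _×_)
open import Data.Sum using (_⊎_)
open import Relation.Binary.PropositionalEquality using (_≡_; _≢_)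
open import Relation.Binary.Construct.Closure.ReflexiveTransitive using (Star)
open import Function using (Bijective)

-- A word of length n over letters {1,…,n}, encoded with letters in Fin n
-- (letter i+1 is encoded as i : Fin n, so letter 1 is zero).
Word : ℕ → Set
Word n = Fin n → Fin n

IsPerm : ∀ {n} → Word n → Set
IsPerm {n} w = Bijective {A = Fin n} {B = Fin n} _≡_ _≡_ w

Perm : ℕ → Set
Perm n = Σ (Word n) IsPerm

StrictlyIncreasing : ∀ {k n} → (Fin k → Fin n) → Set
StrictlyIncreasing f = ∀ {a b} → a < b → f a < f b

Step : (k : ℕ) → ∀ {n} → Word n → Word n → Set
Step k {n} w w' =
  Σ (Fin k → Fin n) λ p →
    StrictlyIncreasing p
    × ((∀ {a b} → a < b → w (p a) < w (p b)) ⊎ (∀ {a b} → a < b → w (p a) > w (p b)))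
    × (∀ j → w' (p j) ≡ w (p (opposite j)))
    × (∀ i → (∀ j → p j ≢ i) → w' i ≡ w i)

-- The {12⋯k, k⋯21}-equivalence: finitely many replacements.
-- (Step is symmetric, so the reflexive-transitive closure is an equivalence.)
Equiv : (k : ℕ) → ∀ {n} → Word n → Word n → Set
Equiv k = Star (Step k)

-- Write k = K + 1, so that the bound on n reads n ≥ 3K² + 3.  By the Erdős–Szekeres
-- theorem any K² + 1 positions of a permutation carry a monotone subsequence of length k,
-- and at most one replacement gives it the orientation we want.  As long as more than K²
-- positions follow the letter 1, an increasing subsequence of K letters after it, together
-- with the 1 in front, is an occurrence of 12⋯k whose reversal moves the 1 further right.
-- Once at most K² positions follow the 1, at least 2K² + 1 positions lie strictly between
-- the first position and the 1, so K² + 1 of them carry letters all smaller, or all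
-- larger, than the first letter.  This yields an occurrence of k⋯21 that starts at the
-- first position and ends at the 1 (for larger letters, after reversing an occurrence of
-- 12⋯k that starts at the first position); reversing it puts the 1 first.
module Submission where

open import Defs
open import Data.Nat using (ℕ; _≤_; _+_; _*_; _∸_)
open import Data.Fin using (Fin; toℕ)
open import Data.Product using (Σ; _×_; proj₁)
open import Relation.Binary.PropositionalEquality using (_≡_)

open import Level using (Level; _⊔_)
open import Data.Empty using (⊥-elim)
open import Data.Nat using (zero; suc; z≤n; s≤s; z<s; _≤?_)
import Data.Nat as ℕ
import Data.Nat.Properties as ℕₚ
open import Data.Nat.Tactic.RingSolver using (solve-∀)
open import Data.Fin using (zero; suc; _<_; _>_; opposite)
open import Data.Fin.Induction using (>-wellFounded)
import Data.Fin.Properties as Finₚ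
open import Data.Fin.Properties using (_<?_)
open import Data.List using (List; []; _∷_; [_]; _∷ʳ_; length; lookup; take; filter; allFin)
import Data.List.Properties as Listₚ
open import Data.List.Membership.Propositional using (_∈_; find)
open import Data.List.Membership.Propositional.Properties using (∈-lookup; ∈-filter⁻)
open import Data.List.Relation.Binary.Subset.Propositional using (_⊆_)
open import Data.List.Relation.Binary.Subset.Propositional.Properties using (filter-⊆)
open import Data.List.Relation.Unary.All as All using (All; []; _∷_)
import Data.List.Relation.Unary.All.Properties as Allₚ
open import Data.List.Relation.Unary.AllPairs as AllPairs using (AllPairs; []; _∷_)
import Data.List.Relation.Unary.AllPairs.Properties as AllPairsₚ
open import Data.List.Relation.Unary.Any using (here; there)
open import Data.Product using (∃; _,_; proj₂)
open import Data.Sum using (_⊎_; inj₁; inj₂)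
open import Function using (_∘_; flip; Injective; Bijective)
open import Function.Consequences using (inverseᵇ⇒bijective)
open import Function.Consequences.Propositional using (strictlyInverseˡ⇒inverseˡ; strictlyInverseʳ⇒inverseʳ)
import Function.Construct.Composition as Composition
open import Induction.WellFounded using (Acc; acc)
open import Relation.Binary using (Rel; tri<; tri≈; tri>)
open import Relation.Binary.Construct.Closure.ReflexiveTransitive using (ε; _◅_; _◅◅_)
open import Relation.Binary.PropositionalEquality
  using (_≢_; refl; sym; trans; cong; subst; subst₂; module ≡-Reasoning)
open import Relation.Nullary using (¬_; yes; no)
open import Relation.Nullary.Decidable using (_→-dec_)
open import Relation.Unary using (Pred; Decidable)
open import Relation.Unary.Properties using (∁?)

private
  variable
    a ℓ : Level
    A : Set a

length-filter-∁ : {P : Pred A ℓ} (P? : Decidable P) (xs : List A) →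
                  length (filter P? xs) + length (filter (∁? P?) xs) ≡ length xs
length-filter-∁ P? [] = refl
length-filter-∁ P? (x ∷ xs) with P? x
... | yes _ = cong suc (length-filter-∁ P? xs)
... | no  _ = trans (ℕₚ.+-suc _ _) (cong suc (length-filter-∁ P? xs))

length-take-≤ : ∀ r (xs : List A) → r ≤ length xs → length (take r xs) ≡ r
length-take-≤ r xs r≤ = trans (Listₚ.length-take r xs) (ℕₚ.m≤n⇒m⊓n≡m r≤)

length-take-suc : ∀ r (xs : List A) → length xs ≡ suc r → length (take r xs) ≡ r
length-take-suc r xs len = length-take-≤ r xs (ℕₚ.≤-trans (ℕₚ.n≤1+n r) (ℕₚ.≤-reflexive (sym len)))

take-⊆ : ∀ r (xs : List A) → take r xs ⊆ xs
take-⊆ (suc r) (x ∷ xs) (here x≡y) = here x≡y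
take-⊆ (suc r) (x ∷ xs) (there y∈) = there (take-⊆ r xs y∈)

lookup-last : (x : A) (xs : List A) (y : A) → lookup (x ∷ xs ∷ʳ y) (opposite zero) ≡ y
lookup-last x []        y = refl
lookup-last x (x′ ∷ xs) y = lookup-last x′ xs y

module _ {R : Rel A ℓ} where

  AllPairs-lookup⁺ : ∀ {xs} → AllPairs R xs → ∀ {i j} → i < j → R (lookup xs i) (lookup xs j)
  AllPairs-lookup⁺ (Rx ∷ _)   {zero}  {suc j} _         = All.lookup Rx (∈-lookup j)
  AllPairs-lookup⁺ (_ ∷ Rxs)  {suc i} {suc j} (s≤s i<j) = AllPairs-lookup⁺ Rxs i<j

  AllPairs-lookup⁻ : ∀ xs → (∀ {i j} → i < j → R (lookup xs i) (lookup xs j)) → AllPairs R xs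
  AllPairs-lookup⁻ xs f = subst (AllPairs R) (Listₚ.tabulate-lookup xs) (AllPairsₚ.tabulate⁺-< f)

  AllPairs-refine : ∀ {S : Rel A ℓ} {xs} → AllPairs R xs →
                    All (λ y → All (λ x → R x y → S x y) xs) xs →
                    AllPairs (λ x y → R x y × S x y) xs
  AllPairs-refine []         _            = []
  AllPairs-refine (Rx ∷ Rxs) (_ ∷ S⇐R) =
    All.zipWith (λ (Rxy , S⇐Ry) → Rxy , All.head S⇐Ry Rxy) (Rx , S⇐R)
    ∷ AllPairs-refine Rxs (All.map All.tail S⇐R)

opposite-< : ∀ {m} {i j : Fin m} → i < j → opposite j < opposite i
opposite-< {suc m} {i} {j} i<j rewrite Finₚ.opposite-prop i | Finₚ.opposite-prop j =
  ℕₚ.∸-monoʳ-< (s≤s i<j) (Finₚ.toℕ<n j)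

module _ {n : ℕ} where

  Sorted : List (Fin n) → Set
  Sorted = AllPairs _<_

  allFin-sorted : Sorted (allFin n)
  allFin-sorted = AllPairsₚ.tabulate⁺-< (λ i<j → i<j)

  sorted-lookup-injective : ∀ {ys} → Sorted ys → ∀ {i j} → lookup ys i ≡ lookup ys j → i ≡ j
  sorted-lookup-injective sorted {i} {j} eq with Finₚ.<-cmp i j
  ... | tri< i<j _ _ = ⊥-elim (Finₚ.<⇒≢ (AllPairs-lookup⁺ sorted i<j) eq)
  ... | tri≈ _ i≡j _ = i≡j
  ... | tri> _ _ j<i = ⊥-elim (Finₚ.<⇒≢ (AllPairs-lookup⁺ sorted j<i) (sym eq))

  sorted∧constant⇒length≤1 : ∀ {c ys} → Sorted ys → All (_≡ c) ys → length ys ≤ 1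
  sorted∧constant⇒length≤1 []                 _                = z≤n
  sorted∧constant⇒length≤1 (_ ∷ [])           _                = s≤s z≤n
  sorted∧constant⇒length≤1 ((x<y ∷ _) ∷ _ ∷ _) (refl ∷ refl ∷ _) = ⊥-elim (Finₚ.<-irrefl refl x<y)

record Ordered {n m : ℕ} (S : Rel (Fin m) ℓ) (w : Fin n → Fin m) (i j : Fin n) : Set ℓ where
  constructor ordered
  field
    positions : i < j
    letters   : S (w i) (w j)

module _ {n m : ℕ} where

  Chain : Rel (Fin m) ℓ → (Fin n → Fin m) → List (Fin n) → Set ℓ
  Chain S w = AllPairs (Ordered S w)

  Increasing Decreasing Monotone : (Fin n → Fin m) → List (Fin n) → Set
  Increasing = Chain _<_
  Decreasing = Chain _>_
  Monotone w ys = Increasing w ys ⊎ Decreasing w ys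

  chain⇒sorted : ∀ {S : Rel (Fin m) ℓ} {w ys} → Chain S w ys → Sorted ys
  chain⇒sorted = AllPairs.map Ordered.positions

  monotone⇒sorted : ∀ {w ys} → Monotone w ys → Sorted ys
  monotone⇒sorted (inj₁ inc) = chain⇒sorted inc
  monotone⇒sorted (inj₂ dec) = chain⇒sorted dec

-- The Erdős–Szekeres theorem

record Subsequence {A : Set a} (P : List A → Set ℓ) (xs : List A) (l : ℕ) : Set (a ⊔ ℓ) where
  constructor subsequence
  field
    elements  : List A
    length≡   : length elements ≡ l
    satisfies : P elements
    ⊆xs       : elements ⊆ xs

module ErdősSzekeres {n m : ℕ} (w : Fin n → Fin m) (w-injective : Injective _≡_ _≡_ w) where

  LeftToRightMinimum : List (Fin n) → Fin n → Set
  LeftToRightMinimum xs y = All (λ x → x < y → w y < w x) xs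

  left-to-right-minimum? : ∀ xs → Decidable (LeftToRightMinimum xs)
  left-to-right-minimum? xs y = All.all? (λ x → (x <? y) →-dec (w y <? w x)) xs

  minima others : List (Fin n) → List (Fin n)
  minima xs = filter (left-to-right-minimum? xs) xs
  others xs = filter (∁? (left-to-right-minimum? xs)) xs

  minima-decreasing : ∀ {xs} → Sorted xs → Decreasing w (minima xs)
  minima-decreasing {xs} sorted = AllPairs.map (λ (x<y , wy<wx) → ordered x<y wy<wx) (AllPairs-refine
    (AllPairsₚ.filter⁺ min? sorted)
    (All.map (Allₚ.anti-mono (filter-⊆ min? xs)) (Allₚ.all-filter min? xs)))
    where min? = left-to-right-minimum? xs

  smaller-to-the-left : ∀ {xs y} → ¬ LeftToRightMinimum xs y → ∃ λ x → x ∈ xs × x < y × w x < w y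
  smaller-to-the-left {xs} {y} not-min
    with find (Allₚ.¬All⇒Any¬ (λ x → (x <? y) →-dec (w y <? w x)) xs not-min)
  ... | x , x∈xs , not-smaller with x <? y
  ...   | no  x≮y = ⊥-elim (not-smaller (⊥-elim ∘ x≮y))
  ...   | yes x<y = x , x∈xs , x<y , Finₚ.≤∧≢⇒< (ℕₚ.≮⇒≥ (not-smaller ∘ λ wy<wx _ → wy<wx))
                                      (Finₚ.<⇒≢ x<y ∘ w-injective)

  increasing-∷ : ∀ {x y ys} → x < y × w x < w y → Increasing w (y ∷ ys) → Increasing w (x ∷ y ∷ ys)
  increasing-∷ (x<y , wx<wy) inc@(y<ys ∷ _) =
    (ordered x<y wx<wy ∷ All.map (λ (ordered y<z wy<wz) →
                                    ordered (Finₚ.<-trans x<y y<z) (Finₚ.<-trans wx<wy wy<wz)) y<ys)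
    ∷ inc

  -- Either the left-to-right minima already give a decreasing subsequence of length s + 1, or more
  -- than r s other elements remain; each of them has a smaller element to its left, which extends an
  -- increasing subsequence of length r + 1 among them (found by induction) to length r + 2.
  erdős-szekeres : ∀ r s {xs} → Sorted xs → r * s ℕ.< length xs →
    Subsequence (Increasing w) xs (suc r) ⊎ Subsequence (Decreasing w) xs (suc s)
  erdős-szekeres zero s {x ∷ _} _ _ = inj₁ (subsequence [ x ] refl ([] ∷ []) λ { (here refl) → here refl })
  erdős-szekeres (suc r) s {xs} sorted large with suc s ≤? length (minima xs)
  ... | yes many = inj₂ (subsequence (take (suc s) (minima xs)) (length-take-≤ (suc s) (minima xs) many)
                          (AllPairsₚ.take⁺ (suc s) (minima-decreasing sorted))
                          (filter-⊆ _ xs ∘ take-⊆ (suc s) (minima xs)))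
  ... | no  few  = extend (erdős-szekeres r s (AllPairsₚ.filter⁺ _ sorted) others-large)
    where
    others-large : r * s ℕ.< length (others xs)
    others-large = ℕₚ.+-cancelˡ-< s _ _ (begin-strict
      s + r * s                                     <⟨ large ⟩
      length xs                                     ≡⟨ length-filter-∁ (left-to-right-minimum? xs) xs ⟨
      length (minima xs) + length (others xs)       ≤⟨ ℕₚ.+-monoˡ-≤ (length (others xs)) (ℕₚ.≮⇒≥ few) ⟩
      s + length (others xs)                        ∎)
      where open ℕₚ.≤-Reasoning

    extend : Subsequence (Increasing w) (others xs) (suc r) ⊎ Subsequence (Decreasing w) (others xs) (suc s) →
             Subsequence (Increasing w) xs (suc (suc r)) ⊎ Subsequence (Decreasing w) xs (suc s)
    extend (inj₂ (subsequence ys len dec ⊆others)) = inj₂ (subsequence ys len dec (filter-⊆ _ xs ∘ ⊆others))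
    extend (inj₁ (subsequence (y ∷ ys) len inc ⊆others))
      with smaller-to-the-left (proj₂ (∈-filter⁻ (∁? (left-to-right-minimum? xs)) {xs = xs}
                                                  (⊆others (here refl))))
    ... | x , x∈xs , smaller = inj₁ (subsequence (x ∷ y ∷ ys) (cong suc len) (increasing-∷ smaller inc)
                                       λ { (here refl) → x∈xs ; (there y∈) → filter-⊆ _ xs (⊆others y∈) })

  monotone-subsequence : ∀ r {xs} → Sorted xs → r * r ℕ.< length xs → Subsequence (Monotone w) xs (suc r)
  monotone-subsequence r sorted large with erdős-szekeres r r sorted large
  ... | inj₁ (subsequence ys len inc ⊆xs) = subsequence ys len (inj₁ inc) ⊆xs
  ... | inj₂ (subsequence ys len dec ⊆xs) = subsequence ys len (inj₂ dec) ⊆xs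

-- Reversing the letters at a list of positions

module _ {n : ℕ} where

  mirror : List (Fin n) → Fin n → Fin n
  mirror ys i with Finₚ.any? (λ j → lookup ys j Finₚ.≟ i)
  ... | yes (j , _) = lookup ys (opposite j)
  ... | no  _       = i

  mirror-lookup : ∀ {ys} → Sorted ys → ∀ j → mirror ys (lookup ys j) ≡ lookup ys (opposite j)
  mirror-lookup {ys} sorted j with Finₚ.any? (λ j′ → lookup ys j′ Finₚ.≟ lookup ys j)
  ... | yes (j′ , eq) = cong (lookup ys ∘ opposite) (sorted-lookup-injective sorted eq)
  ... | no  ¬found    = ⊥-elim (¬found (j , refl))

  mirror-outside : ∀ {ys i} → (∀ j → lookup ys j ≢ i) → mirror ys i ≡ i
  mirror-outside {ys} {i} outside with Finₚ.any? (λ j → lookup ys j Finₚ.≟ i)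
  ... | yes (j , eq) = ⊥-elim (outside j eq)
  ... | no  _        = refl

  mirror-∈ : ∀ {ys i} → i ∈ ys → mirror ys i ∈ ys
  mirror-∈ {ys} {i} i∈ys with Finₚ.any? (λ j → lookup ys j Finₚ.≟ i)
  ... | yes (j , _) = ∈-lookup (opposite j)
  ... | no  _       = i∈ys

  mirror-involutive : ∀ {ys} → Sorted ys → ∀ i → mirror ys (mirror ys i) ≡ i
  mirror-involutive {ys} sorted i with Finₚ.any? (λ j → lookup ys j Finₚ.≟ i)
  ... | yes (j , eq) = trans (mirror-lookup sorted (opposite j))
                             (trans (cong (lookup ys) (Finₚ.opposite-involutive j)) eq)
  ... | no  ¬found   = mirror-outside {ys} (λ j eq → ¬found (j , eq))

  reversed : Word n → List (Fin n) → Word n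
  reversed w ys = w ∘ mirror ys

  reversed-isPerm : ∀ {w ys} → IsPerm w → Sorted ys → IsPerm (reversed w ys)
  reversed-isPerm {ys = ys} w-perm sorted =
    Composition.bijective _≡_ _≡_ _≡_ mirror-bijective w-perm
    where
    mirror-bijective : Bijective _≡_ _≡_ (mirror ys)
    mirror-bijective = inverseᵇ⇒bijective _≡_ refl sym trans
      ( strictlyInverseˡ⇒inverseˡ (mirror ys) (mirror-involutive sorted)
      , strictlyInverseʳ⇒inverseʳ (mirror ys) (mirror-involutive sorted))

  reverseAt : (σ : Perm n) (ys : List (Fin n)) → Sorted ys → Perm n
  reverseAt (w , w-perm) ys sorted = reversed w ys , reversed-isPerm w-perm sorted

  reversed-lookup : ∀ w {ys} → Sorted ys → ∀ j → reversed w ys (lookup ys j) ≡ w (lookup ys (opposite j))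
  reversed-lookup w sorted j = cong w (mirror-lookup sorted j)

  reversed-outside : ∀ w {ys i} → All (_≢ i) ys → reversed w ys i ≡ w i
  reversed-outside w {ys} ys≢i = cong w (mirror-outside {ys} (All.lookup ys≢i ∘ ∈-lookup))

  reverse-chain : ∀ {S : Rel (Fin n) ℓ} {w ys} → Chain S w ys → Chain (flip S) (reversed w ys) ys
  reverse-chain {S = S} {w} {ys} chain = AllPairs-lookup⁻ ys λ {i} {j} i<j →
    ordered (Ordered.positions (AllPairs-lookup⁺ chain i<j))
            (subst₂ S (sym (reversed-lookup w sorted j)) (sym (reversed-lookup w sorted i))
                      (Ordered.letters (AllPairs-lookup⁺ chain (opposite-< i<j))))
    where sorted = chain⇒sorted chain

  reverse-step : ∀ {k w ys} → length ys ≡ k → Monotone w ys → Step k w (reversed w ys)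
  reverse-step {w = w} {ys} refl mono =
    lookup ys , AllPairs-lookup⁺ sorted , orientation mono , reversed-lookup w sorted ,
    λ i outside → cong w (mirror-outside {ys} outside)
    where
    sorted = monotone⇒sorted mono
    orientation : Monotone w ys →
      (∀ {a b} → a < b → w (lookup ys a) < w (lookup ys b)) ⊎
      (∀ {a b} → a < b → w (lookup ys a) > w (lookup ys b))
    orientation (inj₁ inc) = inj₁ (Ordered.letters ∘ AllPairs-lookup⁺ inc)
    orientation (inj₂ dec) = inj₂ (Ordered.letters ∘ AllPairs-lookup⁺ dec)

module _ {n : ℕ} where

  record Reaches (k : ℕ) (P : Word n → Set ℓ) (σ : Perm n) : Set ℓ where
    constructor reaches
    field
      target   : Perm n
      equiv    : Equiv k (proj₁ σ) (proj₁ target)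
      property : P (proj₁ target)

  Reaches-map : ∀ {ℓ′ k} {P : Word n → Set ℓ} {Q : Word n → Set ℓ′} {σ} →
                (∀ {w} → P w → Q w) → Reaches k P σ → Reaches k Q σ
  Reaches-map f (reaches τ σ~τ pτ) = reaches τ σ~τ (f pτ)

  _>>=_ : ∀ {ℓ′ k} {P : Word n → Set ℓ} {Q : Word n → Set ℓ′} {σ} →
          Reaches k P σ → (∀ τ → P (proj₁ τ) → Reaches k Q τ) → Reaches k Q σ
  reaches τ σ~τ pτ >>= f with f τ pτ
  ... | reaches υ τ~υ qυ = reaches υ (σ~τ ◅◅ τ~υ) qυ

  record RearrangedWithin (ys : List (Fin n)) (w w′ : Word n) : Set₁ where
    field
      outside : ∀ {i} → All (_≢ i) ys → w′ i ≡ w i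
      inside  : ∀ {Q : Pred (Fin n) Level.zero} → All (Q ∘ w) ys → All (Q ∘ w′) ys
  open RearrangedWithin

  unchanged : ∀ {ys w} → RearrangedWithin ys w w
  unchanged = record { outside = λ _ → refl ; inside = λ Qys → Qys }

  reversed-rearranged : ∀ {ys w} → RearrangedWithin ys w (reversed w ys)
  reversed-rearranged {w = w} = record
    { outside = reversed-outside w
    ; inside  = λ Qys → All.tabulate (All.lookup Qys ∘ mirror-∈)
    }

  make-increasing : ∀ {k} (σ : Perm n) {ys} → length ys ≡ k → Monotone (proj₁ σ) ys →
    Reaches k (λ w → Increasing w ys × RearrangedWithin ys (proj₁ σ) w) σ
  make-increasing σ _   (inj₁ inc) = reaches σ ε (inc , unchanged)
  make-increasing σ len (inj₂ dec) =
    reaches (reverseAt σ _ (chain⇒sorted dec)) (reverse-step len (inj₂ dec) ◅ ε)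
            (reverse-chain dec , reversed-rearranged)

  make-decreasing : ∀ {k} (σ : Perm n) {ys} → length ys ≡ k → Monotone (proj₁ σ) ys →
    Reaches k (λ w → Decreasing w ys × RearrangedWithin ys (proj₁ σ) w) σ
  make-decreasing σ len (inj₁ inc) =
    reaches (reverseAt σ _ (chain⇒sorted inc)) (reverse-step len (inj₁ inc) ◅ ε)
            (reverse-chain inc , reversed-rearranged)
  make-decreasing σ _   (inj₂ dec) = reaches σ ε (dec , unchanged)

-- Moving the letter 1 to the front

module OneToFront (m n : ℕ) where

  private
    K k : ℕ
    K = suc m
    k = suc K

  open RearrangedWithin

  Position : Set
  Position = Fin (suc n)

  first : Position
  first = zero

  injective : (σ : Perm (suc n)) → Injective _≡_ _≡_ (proj₁ σ)
  injective σ = proj₁ (proj₂ σ)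

  one-is-least : (σ : Perm (suc n)) {q i : Position} → proj₁ σ q ≡ zero → i ≢ q → proj₁ σ q < proj₁ σ i
  one-is-least σ {q} {i} σq≡0 i≢q rewrite σq≡0 =
    Finₚ.≤∧≢⇒< {i = zero} z≤n λ 0≡σi → i≢q (injective σ (trans (sym 0≡σi) (sym σq≡0)))

  Run : (Rel Position Level.zero) → List Position → Word (suc n) → Word (suc n) → Set₁
  Run S xs w₀ w = Subsequence (λ cs → Chain S w cs × RearrangedWithin cs w₀ w) xs k

  increasing-run : (σ : Perm (suc n)) {xs : List Position} → Sorted xs → K * K ℕ.< length xs →
    Reaches k (Run _<_ xs (proj₁ σ)) σ
  increasing-run σ sorted large with ErdősSzekeres.monotone-subsequence (proj₁ σ) (injective σ) K sorted large
  ... | subsequence cs len mono ⊆xs = Reaches-map (λ run → subsequence cs len run ⊆xs) (make-increasing σ len mono)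

  decreasing-run : (σ : Perm (suc n)) {xs : List Position} → Sorted xs → K * K ℕ.< length xs →
    Reaches k (Run _>_ xs (proj₁ σ)) σ
  decreasing-run σ sorted large with ErdősSzekeres.monotone-subsequence (proj₁ σ) (injective σ) K sorted large
  ... | subsequence cs len mono ⊆xs = Reaches-map (λ run → subsequence cs len run ⊆xs) (make-decreasing σ len mono)

  after : Position → List Position
  after q = filter (q <?_) (allFin (suc n))

  OneRightOf : Position → Word (suc n) → Set
  OneRightOf q w = ∃ λ q′ → q < q′ × w q′ ≡ zero

  shift-one-right : (σ : Perm (suc n)) {q : Position} → proj₁ σ q ≡ zero → ∀ ys → length ys ≡ K →
    Increasing (proj₁ σ) ys → All (q <_) ys → Reaches k (OneRightOf q) σ
  shift-one-right σ {q} σq≡0 (y ∷ ys) len inc q<ys =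
    reaches (reverseAt σ zs sorted) (reverse-step (cong suc len) (inj₁ inc′) ◅ ε)
            (lookup zs (opposite zero) , AllPairs-lookup⁺ sorted {zero} {opposite zero} z<s , moved)
    where
    zs = q ∷ y ∷ ys
    inc′ : Increasing (proj₁ σ) zs
    inc′ = All.map (λ q<z → ordered q<z (one-is-least σ σq≡0 (Finₚ.<⇒≢ q<z ∘ sym))) q<ys
           ∷ inc
    sorted = chain⇒sorted inc′
    moved : reversed (proj₁ σ) zs (lookup zs (opposite zero)) ≡ zero
    moved = trans (reversed-lookup (proj₁ σ) sorted (opposite zero))
                  (trans (cong (proj₁ σ ∘ lookup zs) (Finₚ.opposite-involutive zero)) σq≡0)

  push-one-right : (σ : Perm (suc n)) {q : Position} → proj₁ σ q ≡ zero → K * K ℕ.< length (after q) →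
    Reaches k (OneRightOf q) σ
  push-one-right σ {q} σq≡0 large =
    increasing-run σ (AllPairsₚ.filter⁺ (q <?_) allFin-sorted) large
      >>= λ τ (subsequence cs len (inc , rearranged) ⊆after) →
    let q<cs = Allₚ.anti-mono ⊆after (Allₚ.all-filter (q <?_) (allFin (suc n)))
        τq≡0 = trans (outside rearranged (All.map (λ q<c → Finₚ.<⇒≢ q<c ∘ sym) q<cs)) σq≡0
    in shift-one-right τ τq≡0 (take K cs) (length-take-suc K cs len)
                       (AllPairsₚ.take⁺ K inc) (Allₚ.take⁺ K q<cs)

  OneNearEnd : Word (suc n) → Set
  OneNearEnd w = ∃ λ q → w q ≡ zero × length (after q) ≤ K * K

  one-near-end : (σ : Perm (suc n)) {q : Position} → proj₁ σ q ≡ zero → Acc _>_ q → Reaches k OneNearEnd σ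
  one-near-end σ {q} σq≡0 (acc further) with K * K ℕ.<? length (after q)
  ... | no  few   = reaches σ ε (q , σq≡0 , ℕₚ.≮⇒≥ few)
  ... | yes large = push-one-right σ σq≡0 large >>= λ τ (q′ , q<q′ , τq′≡0) →
                    one-near-end τ τq′≡0 (further q<q′)

  not-after before between : Position → List Position
  not-after q = filter (∁? (q <?_)) (allFin (suc n))
  before q    = filter (_<? q) (not-after q)
  between q   = filter (first <?_) (before q)

  before-sorted : ∀ q → Sorted (before q)
  before-sorted q = AllPairsₚ.filter⁺ (_<? q) (AllPairsₚ.filter⁺ (∁? (q <?_)) allFin-sorted)

  between-sorted : ∀ q → Sorted (between q)
  between-sorted q = AllPairsₚ.filter⁺ (first <?_) (before-sorted q)

  Between : Position → Position → Set
  Between q j = first < j × j < q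

  between-inside : ∀ q → All (Between q) (between q)
  between-inside q = All.zip (Allₚ.all-filter (first <?_) (before q) ,
                              Allₚ.filter⁺ (first <?_) (Allₚ.all-filter (_<? q) (not-after q)))

  length-after-between : ∀ q → suc n ≤ length (after q) + (length (between q) + 2)
  length-after-between q = begin
    suc n                                               ≡⟨ Listₚ.length-tabulate {n = suc n} (λ i → i) ⟨
    length (allFin (suc n))                             ≡⟨ length-filter-∁ (q <?_) (allFin (suc n)) ⟨
    #after + length (not-after q)                       ≡⟨ cong (#after +_) (length-filter-∁ (_<? q) (not-after q)) ⟨
    #after + (length (before q) + length at-q)          ≡⟨ cong (λ l → #after + (l + length at-q))
                                                                (length-filter-∁ (first <?_) (before q)) ⟨
    #after + (#between + length at-zero + length at-q)  ≤⟨ ℕₚ.+-monoʳ-≤ #after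
                                                                (ℕₚ.+-mono-≤ (ℕₚ.+-monoʳ-≤ #between at-zero≤1) at-q≤1) ⟩
    #after + (#between + 1 + 1)                         ≡⟨ cong (#after +_) (ℕₚ.+-assoc #between 1 1) ⟩
    #after + (#between + 2)                             ∎
    where
    open ℕₚ.≤-Reasoning
    #after   = length (after q)
    #between = length (between q)
    at-q    = filter (∁? (_<? q)) (not-after q)
    at-zero = filter (∁? (first <?_)) (before q)
    at-q≤1 : length at-q ≤ 1
    at-q≤1 = sorted∧constant⇒length≤1
      (AllPairsₚ.filter⁺ (∁? (_<? q)) (AllPairsₚ.filter⁺ (∁? (q <?_)) allFin-sorted))
      (All.zipWith (λ (q≮j , j≮q) → Finₚ.≤-antisym (ℕₚ.≮⇒≥ q≮j) (ℕₚ.≮⇒≥ j≮q))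
                   (Allₚ.filter⁺ (∁? (_<? q)) (Allₚ.all-filter (∁? (q <?_)) (allFin (suc n))) ,
                    Allₚ.all-filter (∁? (_<? q)) (not-after q)))
    at-zero≤1 : length at-zero ≤ 1
    at-zero≤1 = sorted∧constant⇒length≤1 (AllPairsₚ.filter⁺ (∁? (first <?_)) (before-sorted q))
      (All.map (λ 0≮j → Finₚ.≤-antisym (ℕₚ.≮⇒≥ 0≮j) z≤n) (Allₚ.all-filter (∁? (first <?_)) (before q)))

  between-large : ∀ q → length (after q) ≤ K * K → 3 * (K * K) + 3 ≤ suc n →
                  K * K + K * K ℕ.< length (between q)
  between-large q few bound = ℕₚ.+-cancelʳ-≤ 2 _ _ (ℕₚ.+-cancelˡ-≤ (K * K) _ _ (begin
    K * K + (suc (K * K + K * K) + 2)              ≡⟨ three-times (K * K) ⟩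
    3 * (K * K) + 3                                ≤⟨ bound ⟩
    suc n                                          ≤⟨ length-after-between q ⟩
    length (after q) + (length (between q) + 2)    ≤⟨ ℕₚ.+-monoˡ-≤ _ few ⟩
    K * K + (length (between q) + 2)               ∎))
    where
    open ℕₚ.≤-Reasoning
    three-times : ∀ x → x + (suc (x + x) + 2) ≡ 3 * x + 3
    three-times = solve-∀

  OneFirst : Word (suc n) → Set
  OneFirst w = (z : Position) → toℕ z ≡ 0 → toℕ (w z) ≡ 0

  one-first : ∀ {w} → w first ≡ zero → OneFirst w
  one-first w₀≡0 zero _ = cong toℕ w₀≡0

  move-one-to : (σ : Perm (suc n)) {q : Position} → proj₁ σ q ≡ zero → ∀ x mid → length mid ≡ m →
    Decreasing (proj₁ σ) (x ∷ mid) → All (_< q) (x ∷ mid) → Reaches k (λ w → w x ≡ zero) σ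
  move-one-to σ {q} σq≡0 x mid len dec before-q =
    reaches (reverseAt σ zs sorted) (reverse-step zs-length (inj₂ dec′) ◅ ε) moved
    where
    zs = x ∷ mid ∷ʳ q
    dec′ : Decreasing (proj₁ σ) zs
    dec′ = AllPairsₚ.++⁺ dec ([] ∷ [])
             (All.map (λ d<q → ordered d<q (one-is-least σ σq≡0 (Finₚ.<⇒≢ d<q)) ∷ []) before-q)
    sorted = chain⇒sorted dec′
    zs-length : length zs ≡ k
    zs-length = cong suc (trans (Listₚ.length-++ mid) (trans (cong (_+ 1) len) (ℕₚ.+-comm m 1)))
    moved : reversed (proj₁ σ) zs x ≡ zero
    moved = trans (reversed-lookup (proj₁ σ) sorted zero) (trans (cong (proj₁ σ) (lookup-last x mid q)) σq≡0)

  ends-fixed : ∀ {q cs w₀ w} → RearrangedWithin cs w₀ w → All (Between q) cs →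
               w q ≡ w₀ q × w first ≡ w₀ first
  ends-fixed rearranged between =
    outside rearranged (All.map (λ (_ , j<q) → Finₚ.<⇒≢ j<q) between) ,
    outside rearranged (All.map (λ (0<j , _) → Finₚ.<⇒≢ 0<j ∘ sym) between)

  one-first-via-smaller : (σ : Perm (suc n)) {q : Position} → proj₁ σ q ≡ zero → first < q →
    ∀ {xs} → Sorted xs → K * K ℕ.< length xs →
    All (Between q) xs → All (λ j → proj₁ σ j < proj₁ σ first) xs → Reaches k OneFirst σ
  one-first-via-smaller σ {q} σq≡0 0<q sorted large xs-between xs-smaller =
    decreasing-run σ sorted large >>= λ τ (subsequence cs len (dec , rearranged) ⊆xs) →
    let cs-between = Allₚ.anti-mono ⊆xs xs-between
        τq≡σq , τ₀≡σ₀ = ends-fixed rearranged cs-between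
        smaller : All (λ j → proj₁ τ j < proj₁ τ first) cs
        smaller = subst (λ a → All (λ j → proj₁ τ j < a) cs) (sym τ₀≡σ₀)
                        (inside rearranged {Q = _< proj₁ σ first} (Allₚ.anti-mono ⊆xs xs-smaller))
    in Reaches-map one-first (move-one-to τ (trans τq≡σq σq≡0) first (take m cs)
         (length-take-≤ m cs (ℕₚ.≤-trans (ℕₚ.m≤n+m m 2) (ℕₚ.≤-reflexive (sym len))))
         (Allₚ.take⁺ m (All.zipWith (λ ((0<j , _) , τj<τ₀) → ordered 0<j τj<τ₀) (cs-between , smaller))
          ∷ AllPairsₚ.take⁺ m dec)
         (0<q ∷ Allₚ.take⁺ m (All.map proj₂ cs-between)))

  one-first-via-larger : (σ : Perm (suc n)) {q : Position} → proj₁ σ q ≡ zero → first < q →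
    ∀ {xs} → Sorted xs → K * K ℕ.< length xs →
    All (Between q) xs → All (λ j → proj₁ σ first < proj₁ σ j) xs → Reaches k OneFirst σ
  one-first-via-larger σ {q} σq≡0 0<q sorted large xs-between xs-larger =
    increasing-run σ sorted large >>= λ τ (subsequence cs len (inc , rearranged) ⊆xs) →
    let cs-between = Allₚ.anti-mono ⊆xs xs-between
        τq≡σq , τ₀≡σ₀ = ends-fixed rearranged cs-between
        larger : All (λ j → proj₁ τ first < proj₁ τ j) cs
        larger = subst (λ a → All (λ j → a < proj₁ τ j) cs) (sym τ₀≡σ₀)
                       (inside rearranged {Q = proj₁ σ first <_} (Allₚ.anti-mono ⊆xs xs-larger))
        front = take K cs
        front-length = length-take-suc K cs len
        zs = first ∷ front
        zs<q : All (_< q) zs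
        zs<q = 0<q ∷ Allₚ.take⁺ K (All.map proj₂ cs-between)
        inc′ : Increasing (proj₁ τ) zs
        inc′ = Allₚ.take⁺ K (All.zipWith (λ ((0<j , _) , τ₀<τj) → ordered 0<j τ₀<τj) (cs-between , larger))
               ∷ AllPairsₚ.take⁺ K inc
    in make-decreasing τ (cong suc front-length) (inj₁ inc′) >>= λ υ (dec , rearranged′) →
       let υq≡0 = trans (outside rearranged′ (All.map Finₚ.<⇒≢ zs<q)) (trans τq≡σq σq≡0)
       in Reaches-map one-first (move-one-to υ υq≡0 first (take m front) (length-take-suc m front front-length)
                                (AllPairsₚ.take⁺ K dec) (Allₚ.take⁺ K zs<q))

  smaller-than-first? : (σ : Perm (suc n)) → Decidable (λ j → proj₁ σ j < proj₁ σ first)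
  smaller-than-first? σ j = proj₁ σ j <? proj₁ σ first

  smaller-than-first larger-than-first : Perm (suc n) → Position → List Position
  smaller-than-first σ q = filter (smaller-than-first? σ) (between q)
  larger-than-first  σ q = filter (∁? (smaller-than-first? σ)) (between q)

  few-smaller⇒many-larger : ∀ σ q → length (after q) ≤ K * K → 3 * (K * K) + 3 ≤ suc n →
    length (smaller-than-first σ q) ≤ K * K → K * K ℕ.< length (larger-than-first σ q)
  few-smaller⇒many-larger σ q few bound few-smaller = ℕₚ.+-cancelˡ-< (K * K) _ _ (begin-strict
    K * K + K * K                                                        <⟨ between-large q few bound ⟩
    length (between q)                                                   ≡⟨ length-filter-∁ (smaller-than-first? σ) (between q) ⟨
    length (smaller-than-first σ q) + length (larger-than-first σ q)     ≤⟨ ℕₚ.+-monoˡ-≤ _ few-smaller ⟩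
    K * K + length (larger-than-first σ q)                               ∎)
    where open ℕₚ.≤-Reasoning

  one-first-from : (σ : Perm (suc n)) {q : Position} → proj₁ σ q ≡ zero → length (after q) ≤ K * K →
    3 * (K * K) + 3 ≤ suc n → Reaches k OneFirst σ
  one-first-from σ {zero}  σq≡0 _   _     = reaches σ ε (one-first σq≡0)
  one-first-from σ {suc q} σq≡0 few bound with K * K ℕ.<? length (smaller-than-first σ (suc q))
  ... | yes many-smaller = one-first-via-smaller σ σq≡0 z<s
    (AllPairsₚ.filter⁺ (smaller-than-first? σ) (between-sorted (suc q))) many-smaller
    (Allₚ.filter⁺ (smaller-than-first? σ) (between-inside (suc q)))
    (Allₚ.all-filter (smaller-than-first? σ) (between (suc q)))
  ... | no few-smaller = one-first-via-larger σ σq≡0 z<s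
    (AllPairsₚ.filter⁺ (∁? (smaller-than-first? σ)) (between-sorted (suc q)))
    (few-smaller⇒many-larger σ (suc q) few bound (ℕₚ.≮⇒≥ few-smaller))
    larger-between
    (All.zipWith (λ ((0<j , _) , σj≮σ₀) → Finₚ.≤∧≢⇒< (ℕₚ.≮⇒≥ σj≮σ₀) (Finₚ.<⇒≢ 0<j ∘ injective σ))
                 (larger-between , Allₚ.all-filter (∁? (smaller-than-first? σ)) (between (suc q))))
    where larger-between = Allₚ.filter⁺ (∁? (smaller-than-first? σ)) (between-inside (suc q))

  one-to-front : 3 * (K * K) + 3 ≤ suc n → (σ : Perm (suc n)) → Reaches k OneFirst σ
  one-to-front bound σ =
    one-near-end σ σq≡0 (>-wellFounded q) >>= λ τ (q′ , τq′≡0 , few) → one-first-from τ τq′≡0 few bound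
    where
    q = proj₁ (proj₂ (proj₂ σ) zero)
    σq≡0 = proj₂ (proj₂ (proj₂ σ) zero) refl

-- The truncated subtraction is exact: 6k ≤ 3k² for k ≥ 2.
threshold : ∀ m → 3 * (2 + m) * (2 + m) ∸ 6 * (2 + m) + 6 ≡ 3 * ((1 + m) * (1 + m)) + 3
threshold m = begin
  3 * (2 + m) * (2 + m) ∸ 6 * (2 + m) + 6                ≡⟨ cong (λ t → t ∸ 6 * (2 + m) + 6) (expand m) ⟩
  (3 * m * m + 6 * m) + 6 * (2 + m) ∸ 6 * (2 + m) + 6    ≡⟨ cong (_+ 6) (ℕₚ.m+n∸n≡m (3 * m * m + 6 * m) (6 * (2 + m))) ⟩
  3 * m * m + 6 * m + 6                                  ≡⟨ collect m ⟩
  3 * ((1 + m) * (1 + m)) + 3                            ∎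
  where
  open ≡-Reasoning
  expand : ∀ m → 3 * (2 + m) * (2 + m) ≡ (3 * m * m + 6 * m) + 6 * (2 + m)
  expand = solve-∀
  collect : ∀ m → 3 * m * m + 6 * m + 6 ≡ 3 * ((1 + m) * (1 + m)) + 3
  collect = solve-∀

lemma2p3 : (k n : ℕ) → 2 ≤ k → 3 * k * k ∸ 6 * k + 6 ≤ n →
    (σ : Perm n) →
      Σ (Perm n) λ τ → Equiv k (proj₁ σ) (proj₁ τ) × ((z : Fin n) → toℕ z ≡ 0 → toℕ (proj₁ τ z) ≡ 0)
lemma2p3 (suc (suc m)) zero (s≤s (s≤s z≤n)) bound _
  with () ← ℕₚ.m+n≤o⇒n≤o (3 * (2 + m) * (2 + m) ∸ 6 * (2 + m)) bound
lemma2p3 (suc (suc m)) (suc n) (s≤s (s≤s z≤n)) bound σ = target , equiv , property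
  where open Reaches (OneToFront.one-to-front m n (subst (_≤ suc n) (threshold m) bound) σ)
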